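{- Let $G$ be an ordered abelian group such that for each prime $p$ there exists an integer $N_p > 1$ with $|R_H^{\mathfrak{s}_p}| < N_p$ for every $H \in \mathcal{S}_p \setminus \{\emptyset\}$. Then for each prime $p$ and each integer $r \geq 1$ there exists an integer $N_{p^r} > 1$ such that $|R_H^{\mathfrak{s}_{p^r}}| < N_{p^r}$ for every $H \in \mathcal{S}_p \setminus \{\emptyset\}$.
   Context: Convex subgroups of $G$ are linearly ordered by inclusion, and $\emptyset < H$ for every convex subgroup $H$. For an integer $n \geq 2$ and $a \in G$: if $a \notin nG$, $\mathfrak{s}_n(a)$ is the largest convex subgroup $H$ of $G$ with $a \notin H + nG$; if $a \in nG$, $\mathfrak{s}_n(a) = \emptyset$. $\mathcal{S}_n = \{\mathfrak{s}_n(a) \mid a \in G\}$. For a convex subgroup $H$, $G^{\mathfrak{s}_n}_{\leq H} = \{a \in G \mid \mathfrak{s}_n(a) \subseteq H\}$ and $G^{\mathfrak{s}_n}_{<H} = \{a \in G\mid \mathfrak{s}_n(a) \subsetneq H\}$ (subgroups of $G$), and $R_H^{\mathfrak{s}_n} = G^{\mathfrak{s}_n}_{\leq H}/G^{\mathfrak{s}_n}_{<H}$. -}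

module Defs where

open import Level using (Level; 0ℓ) renaming (suc to lsuc)
open import Data.Nat using (ℕ; zero; suc)
open import Data.Fin using (Fin)
open import Data.Product using (Σ; ∃; _×_; _,_)
open import Relation.Nullary using (¬_)
open import Relation.Unary using (Pred; _∈_; _∉_; _⊆_)
open import Relation.Binary.PropositionalEquality using (_≡_)
open import Algebra.Structures using (IsAbelianGroup)
open import Relation.Binary.Structures using (IsTotalOrder)

record OrderedAbelianGroup : Set₁ where
  infixl 6 _+_
  infix 4 _≤_
  field
    Carrier        : Set
    _+_            : Carrier → Carrier → Carrier
    0#             : Carrier
    -_             : Carrier → Carrier
    _≤_            : Carrier → Carrier → Set
    isAbelianGroup : IsAbelianGroup _≡_ _+_ 0# -_
    isTotalOrder   : IsTotalOrder _≡_ _≤_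
    +-mono-≤       : ∀ {a b} c → a ≤ b → a + c ≤ b + c

module _ (G : OrderedAbelianGroup) where
  open OrderedAbelianGroup G

  _·_ : ℕ → Carrier → Carrier
  zero  · a = 0#
  suc n · a = a + n · a

  multiples : ℕ → Pred Carrier 0ℓ
  multiples n x = ∃ λ b → x ≡ n · b

  plusMultiples : ∀ {ℓ} → Pred Carrier ℓ → ℕ → Pred Carrier ℓ
  plusMultiples H n x = Σ Carrier λ h → h ∈ H × (∃ λ b → x ≡ h + n · b)

  record IsConvexSubgroup {ℓ} (H : Pred Carrier ℓ) : Set ℓ where
    field
      zero-closed : 0# ∈ H
      +-closed    : ∀ {a b} → a ∈ H → b ∈ H → a + b ∈ H
      neg-closed  : ∀ {a} → a ∈ H → - a ∈ H
      convex      : ∀ {a b c} → a ∈ H → b ∈ H → a ≤ c → c ≤ b → c ∈ H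

  -- s_n(a): if a ∉ nG, the largest convex subgroup H with a ∉ H + nG,
  -- realised as the union of all such convex subgroups (which is the largest one);
  -- if a ∈ nG, the empty set.
  𝔰 : ℕ → Carrier → Pred Carrier (lsuc 0ℓ)
  𝔰 n a x = (a ∉ multiples n) ×
            (Σ (Pred Carrier 0ℓ) λ H → IsConvexSubgroup H × (a ∉ plusMultiples H n) × x ∈ H)

  _≐_ : ∀ {ℓ₁ ℓ₂} → Pred Carrier ℓ₁ → Pred Carrier ℓ₂ → Set _
  A ≐ B = (A ⊆ B) × (B ⊆ A)

  ∅ : Pred Carrier 0ℓ
  ∅ _ = Data.Empty.⊥
    where import Data.Empty

  InS : ℕ → Pred Carrier (lsuc 0ℓ) → Set (lsuc 0ℓ)
  InS n H = ∃ λ a → H ≐ 𝔰 n a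

  G≤ : ℕ → Pred Carrier (lsuc 0ℓ) → Pred Carrier (lsuc 0ℓ)
  G≤ n H a = 𝔰 n a ⊆ H

  G< : ℕ → Pred Carrier (lsuc 0ℓ) → Pred Carrier (lsuc 0ℓ)
  G< n H a = (𝔰 n a ⊆ H) × ¬ (H ⊆ 𝔰 n a)

  -- |A / B| < N  for subgroups B ⊆ A: there is no injection Fin N → A/B,
  -- i.e. no N elements of A pairwise distinct modulo B.
  QuotientCardLt : ∀ {ℓ₁ ℓ₂} → Pred Carrier ℓ₁ → Pred Carrier ℓ₂ → ℕ → Set (ℓ₁ Level.⊔ ℓ₂)
  QuotientCardLt A B N =
    (f : Fin N → Carrier) → (∀ i → f i ∈ A) →
    (∀ i j → (f i + - f j) ∈ B → i ≡ j) → Data.Empty.⊥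
    where import Data.Empty

  RCardLt : ℕ → Pred Carrier (lsuc 0ℓ) → ℕ → Set (lsuc 0ℓ)
  RCardLt n H N = QuotientCardLt (G≤ n H) (G< n H) N

-- Let S = 𝔰_p(c) and B_i = S + p^i G. An element a of G^{𝔰_{p^r}}_{≤S} lying in B_i, a = h + p^i y with
-- h ∈ S and i < r, has its "digit" y in G^{𝔰_p}_{≤S}, and digits congruent modulo S + pG give elements
-- congruent modulo B_{i+1}. As G^{𝔰_p}_{<S} ⊆ S + pG, each layer B_i / B_{i+1} meets fewer than N classes
-- of G^{𝔰_{p^r}}_{≤S}, and as B_r ⊆ G^{𝔰_{p^r}}_{<S}, the r layers together give fewer than N^r.
-- The argument uses case distinctions; they are harmless because every goal is a negation and
-- membership in 𝔰_p(c) is stable under double negation.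
module Submission where

open import Level using (Level; 0ℓ; _⊔_) renaming (suc to lsuc)
open import Function using (_∘_)
open import Data.Empty using (⊥; ⊥-elim)
open import Data.Product using (Σ; ∃; _×_; _,_; proj₁; proj₂)
open import Data.Sum using (_⊎_; inj₁; inj₂)
open import Data.Nat as ℕ using (ℕ; zero; suc; _^_)
import Data.Nat.Properties as ℕₚ
open import Data.Nat.Primality using (Prime; prime⇒nonZero)
import Data.Fin as Fin
import Data.Fin.Properties as Finₚ
open import Data.List using (List; []; _∷_; length; map; tabulate; lookup)
open import Data.List.Properties using (length-map; length-tabulate)
open import Data.List.Membership.Propositional using () renaming (_∈_ to _∈ₗ_)
open import Data.List.Membership.Propositional.Properties using (∈-lookup)
open import Data.List.Relation.Unary.Any using (here; there)
open import Data.List.Relation.Unary.All as All using (All; []; _∷_)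
import Data.List.Relation.Unary.All.Properties as Allₚ
open import Data.List.Relation.Unary.AllPairs as AllPairs using (AllPairs; []; _∷_)
import Data.List.Relation.Unary.AllPairs.Properties as AllPairsₚ
open import Data.List.Relation.Binary.Sublist.Propositional using ([]; _∷_; _∷ʳ_) renaming (_⊆_ to _⊑_)
open import Data.List.Relation.Binary.Sublist.Propositional.Properties using (All-resp-⊆; Any-resp-⊆)
open import Data.List.Relation.Binary.Pointwise using (Pointwise; []; _∷_; Pointwise-length)
open import Relation.Nullary using (¬_; Dec; yes; no)
open import Relation.Nullary.Decidable using (decidable-stable; ¬¬-excluded-middle)
open import Relation.Unary using (Pred; _∈_; _∉_; _⊆_; _∩_)
open import Relation.Binary using (Rel; REL)
open import Relation.Binary.Definitions using (tri<; tri≈; tri>)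
open import Relation.Binary.PropositionalEquality
open import Relation.Binary.Structures using (IsTotalOrder)
open import Algebra.Bundles using (AbelianGroup)
import Algebra.Properties.AbelianGroup as AbelianGroupₚ
import Algebra.Properties.CommutativeSemigroup as CommutativeSemigroupₚ
import Algebra.Properties.CommutativeMonoid.Mult as CommutativeMonoidMultₚ
open import Defs hiding (_·_)
import Defs

module _ where
  private variable
    a b ℓ ℓ′ ℓ″ : Level
    A : Set a
    B : Set b

  AllPairs-lookup : {R : Rel A ℓ} {xs : List A} → AllPairs R xs →
                    ∀ {i j} → i Fin.< j → R (lookup xs i) (lookup xs j)
  AllPairs-lookup (Rx ∷ _)  {Fin.zero}  {Fin.suc j} _ = All.lookup Rx (∈-lookup j)
  AllPairs-lookup (_ ∷ Rxs) {Fin.suc i} {Fin.suc j} (ℕ.s≤s i<j) = AllPairs-lookup Rxs i<j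

  AllPairs-resp-⊑ : {R : Rel A ℓ} {xs ys : List A} → xs ⊑ ys → AllPairs R ys → AllPairs R xs
  AllPairs-resp-⊑ []          []         = []
  AllPairs-resp-⊑ (_ ∷ʳ xs⊑ys) (_ ∷ Rys) = AllPairs-resp-⊑ xs⊑ys Rys
  AllPairs-resp-⊑ (refl ∷ xs⊑ys) (Ry ∷ Rys) = All-resp-⊆ xs⊑ys Ry ∷ AllPairs-resp-⊑ xs⊑ys Rys

  All-¬¬ : {P : Pred A ℓ} → (∀ x → ¬ ¬ P x) → ∀ xs → ¬ ¬ All P xs
  All-¬¬ ¬¬P []       k = k []
  All-¬¬ ¬¬P (x ∷ xs) k = ¬¬P x λ Px → All-¬¬ ¬¬P xs λ Pxs → k (Px ∷ Pxs)

  record Partition {A : Set a} (P : Pred A ℓ) (xs : List A) : Set (a ⊔ ℓ) where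
    field
      inside outside   : List A
      inside⊑          : inside ⊑ xs
      outside⊑         : outside ⊑ xs
      all-inside       : All P inside
      none-outside     : All (¬_ ∘ P) outside
      length-partition : length inside ℕ.+ length outside ≡ length xs

  partition : {P : Pred A ℓ} {xs : List A} → All (Dec ∘ P) xs → Partition P xs
  partition [] = record { inside = [] ; outside = [] ; inside⊑ = [] ; outside⊑ = []
                        ; all-inside = [] ; none-outside = [] ; length-partition = refl }
  partition {xs = x ∷ xs} (P? ∷ Ps?) with P? | partition Ps?
  ... | yes Px | π = record
    { inside = x ∷ inside ; outside = outside ; inside⊑ = refl ∷ inside⊑ ; outside⊑ = x ∷ʳ outside⊑
    ; all-inside = Px ∷ all-inside ; none-outside = none-outside
    ; length-partition = cong suc length-partition }
    where open Partition π
  ... | no ¬Px | π = record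
    { inside = inside ; outside = x ∷ outside ; inside⊑ = x ∷ʳ inside⊑ ; outside⊑ = refl ∷ outside⊑
    ; all-inside = all-inside ; none-outside = ¬Px ∷ none-outside
    ; length-partition = trans (ℕₚ.+-suc (length inside) (length outside)) (cong suc length-partition) }
    where open Partition π

  Pointwise-choice : {R : REL A B ℓ} {P : Pred A ℓ′} → (∀ {x} → P x → ∃ (R x)) →
                     ∀ {xs} → All P xs → ∃ (Pointwise R xs)
  Pointwise-choice choose []         = [] , []
  Pointwise-choice choose (Px ∷ Pxs) with choose Px | Pointwise-choice choose Pxs
  ... | y , Rxy | ys , Rxsys = y ∷ ys , Rxy ∷ Rxsys

  Pointwise-All : {R : REL A B ℓ} {P : Pred B ℓ′} → (∀ {x y} → R x y → P y) →
                  ∀ {xs ys} → Pointwise R xs ys → All P ys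
  Pointwise-All R⇒P []          = []
  Pointwise-All R⇒P (Rxy ∷ Rxsys) = R⇒P Rxy ∷ Pointwise-All R⇒P Rxsys

  Pointwise-AllPairs : {R : REL A B ℓ} {S : Rel A ℓ′} {T : Rel B ℓ″} →
                       (∀ {x x′ y y′} → R x y → R x′ y′ → S x x′ → T y y′) →
                       ∀ {xs ys} → Pointwise R xs ys → AllPairs S xs → AllPairs T ys
  Pointwise-AllPairs transport [] [] = []
  Pointwise-AllPairs {R = R} {S} {T} transport (Rxy ∷ Rxsys) (Sx ∷ Sxs) =
    along Rxsys Sx ∷ Pointwise-AllPairs transport Rxsys Sxs
    where
    along : ∀ {xs ys} → Pointwise R xs ys → All (S _) xs → All (T _) ys
    along []            []         = []
    along (Rx′y′ ∷ Rxsys′) (S′ ∷ Ss) = transport Rxy Rx′y′ S′ ∷ along Rxsys′ Ss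

module _ (G : OrderedAbelianGroup) where
  open OrderedAbelianGroup G
  open IsTotalOrder isTotalOrder using (total) renaming (refl to ≤-refl; trans to ≤-trans)

  abelianGroup : AbelianGroup 0ℓ 0ℓ
  abelianGroup = record
    { Carrier = Carrier ; _≈_ = _≡_ ; _∙_ = _+_ ; ε = 0# ; _⁻¹ = -_ ; isAbelianGroup = isAbelianGroup }

  open AbelianGroup abelianGroup
    using (_-_; assoc; comm; identityˡ; identityʳ; inverseˡ; inverseʳ; commutativeSemigroup; commutativeMonoid)
  open AbelianGroupₚ abelianGroup using (⁻¹-involutive; ε⁻¹≈ε; ⁻¹-∙-comm; ⁻¹-anti-homo‿-; inverseʳ-unique)
  open CommutativeSemigroupₚ commutativeSemigroup using (interchange)
  open CommutativeMonoidMultₚ commutativeMonoid using (×-homo-+; ×-assocˡ; ×-distrib-+) renaming (_×_ to _×ᴹ_)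

  infixr 7 _·_
  _·_ : ℕ → Carrier → Carrier
  _·_ = Defs._·_ G

  ·≗×ᴹ : ∀ n x → n · x ≡ n ×ᴹ x
  ·≗×ᴹ zero    x = refl
  ·≗×ᴹ (suc n) x = cong (x +_) (·≗×ᴹ n x)

  ·-homo-+ : ∀ m n x → (m ℕ.+ n) · x ≡ m · x + n · x
  ·-homo-+ m n x rewrite ·≗×ᴹ (m ℕ.+ n) x | ·≗×ᴹ m x | ·≗×ᴹ n x = ×-homo-+ x m n

  ·-assoc : ∀ m n x → (m ℕ.* n) · x ≡ m · n · x
  ·-assoc m n x rewrite ·≗×ᴹ (m ℕ.* n) x | ·≗×ᴹ m (n · x) | ·≗×ᴹ n x = sym (×-assocˡ x m n)

  ·-distrib-+ : ∀ n x y → n · (x + y) ≡ n · x + n · y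
  ·-distrib-+ n x y rewrite ·≗×ᴹ n (x + y) | ·≗×ᴹ n x | ·≗×ᴹ n y = ×-distrib-+ x y n

  ·-zeroʳ : ∀ n → n · 0# ≡ 0#
  ·-zeroʳ zero    = refl
  ·-zeroʳ (suc n) = trans (identityˡ _) (·-zeroʳ n)

  ·-neg : ∀ n x → n · (- x) ≡ - (n · x)
  ·-neg n x = inverseʳ-unique (n · x) (n · (- x)) (begin
    n · x + n · (- x) ≡⟨ ·-distrib-+ n x (- x) ⟨
    n · (x - x)       ≡⟨ cong (n ·_) (inverseʳ x) ⟩
    n · 0#            ≡⟨ ·-zeroʳ n ⟩
    0#                ∎)
    where open ≡-Reasoning

  ·-distrib-sub : ∀ n x y → n · (x - y) ≡ n · x - n · y
  ·-distrib-sub n x y = trans (·-distrib-+ n x (- y)) (cong (n · x +_) (·-neg n y))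

  -‿distrib-+ : ∀ x y → - (x + y) ≡ - x + - y
  -‿distrib-+ x y = sym (⁻¹-∙-comm x y)

  [x+y]-[u+v]≡[x-u]+[y-v] : ∀ x y u v → (x + y) - (u + v) ≡ (x - u) + (y - v)
  [x+y]-[u+v]≡[x-u]+[y-v] x y u v = trans (cong ((x + y) +_) (-‿distrib-+ u v)) (interchange x y (- u) (- v))

  [x-z]-[y-z]≡x-y : ∀ x y z → (x - z) - (y - z) ≡ x - y
  [x-z]-[y-z]≡x-y x y z =
    trans ([x+y]-[u+v]≡[x-u]+[y-v] x (- z) y (- z)) (trans (cong ((x - y) +_) (inverseʳ (- z))) (identityʳ _))

  [x-y]-[x-z]≡z-y : ∀ x y z → (x - y) - (x - z) ≡ z - y
  [x-y]-[x-z]≡z-y x y z = begin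
    (x - y) - (x - z)     ≡⟨ [x+y]-[u+v]≡[x-u]+[y-v] x (- y) x (- z) ⟩
    (x - x) + (- y - - z) ≡⟨ cong₂ _+_ (inverseʳ x) (cong (- y +_) (⁻¹-involutive z)) ⟩
    0# + (- y + z)        ≡⟨ trans (identityˡ _) (comm (- y) z) ⟩
    z - y                 ∎
    where open ≡-Reasoning

  x-y+y≡x : ∀ x y → (x - y) + y ≡ x
  x-y+y≡x x y = trans (assoc x (- y) y) (trans (cong (x +_) (inverseˡ y)) (identityʳ x))

  x≡y+z⇒z≡x-y : ∀ {x y z} → x ≡ y + z → z ≡ x - y
  x≡y+z⇒z≡x-y {x} {y} {z} refl = sym (trans (cong (_- y) (comm y z)) (trans (assoc z y (- y))
                                  (trans (cong (z +_) (inverseʳ y)) (identityʳ z))))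

  +-mono-≤₂ : ∀ {x y u v} → x ≤ y → u ≤ v → x + u ≤ y + v
  +-mono-≤₂ {x} {y} {u} {v} x≤y u≤v =
    ≤-trans (+-mono-≤ u x≤y) (subst₂ _≤_ (comm u y) (comm v y) (+-mono-≤ y u≤v))

  neg-mono-≤ : ∀ {x y} → x ≤ y → - y ≤ - x
  neg-mono-≤ {x} {y} x≤y = subst₂ _≤_ (cancel x y) (trans (cong (y +_) (comm (- x) (- y))) (cancel y x))
                                     (+-mono-≤ (- x + - y) x≤y)
    where
    cancel : ∀ u w → u + (- u + - w) ≡ - w
    cancel u w = trans (sym (assoc u (- u) (- w))) (trans (cong (_+ - w) (inverseʳ u)) (identityˡ _))

  ·-nonneg : ∀ m {x} → 0# ≤ x → 0# ≤ m · x
  ·-nonneg zero    _   = ≤-refl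
  ·-nonneg (suc m) {x} 0≤x = subst (_≤ x + m · x) (identityˡ 0#) (+-mono-≤₂ 0≤x (·-nonneg m 0≤x))

  ·-nonpos : ∀ m {x} → x ≤ 0# → m · x ≤ 0#
  ·-nonpos zero    _   = ≤-refl
  ·-nonpos (suc m) {x} x≤0 = subst (x + m · x ≤_) (identityˡ 0#) (+-mono-≤₂ x≤0 (·-nonpos m x≤0))

  ·-monoˡ-≤ : ∀ {x} → 0# ≤ x → ∀ m k → m · x ≤ (m ℕ.+ k) · x
  ·-monoˡ-≤ {x} 0≤x m k =
    subst₂ _≤_ (identityʳ _) (sym (·-homo-+ m k x)) (+-mono-≤₂ (≤-refl {m · x}) (·-nonneg k 0≤x))

  infix 4 _≡±_
  _≡±_ : Carrier → Carrier → Set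
  x ≡± u = x ≡ u ⊎ x ≡ - u

  ≡±-sym : ∀ {x u} → x ≡± u → u ≡± x
  ≡±-sym (inj₁ refl) = inj₁ refl
  ≡±-sym (inj₂ refl) = inj₂ (sym (⁻¹-involutive _))

  absolute : ∀ x → Σ Carrier λ u → 0# ≤ u × x ≡± u
  absolute x with total 0# x
  ... | inj₁ 0≤x = x , 0≤x , inj₁ refl
  ... | inj₂ x≤0 = - x , subst (_≤ - x) ε⁻¹≈ε (neg-mono-≤ x≤0) , inj₂ (sym (⁻¹-involutive x))

  ∣_∣ : Carrier → Carrier
  ∣ x ∣ = proj₁ (absolute x)

  module ConvexSubgroup {ℓ} {K : Pred Carrier ℓ} (K-convex : IsConvexSubgroup G K) where
    open IsConvexSubgroup K-convex public

    sub-closed : ∀ {x y} → x ∈ K → y ∈ K → x - y ∈ K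
    sub-closed x∈K y∈K = +-closed x∈K (neg-closed y∈K)

    ·-closed : ∀ n {x} → x ∈ K → n · x ∈ K
    ·-closed zero    _   = zero-closed
    ·-closed (suc n) x∈K = +-closed x∈K (·-closed n x∈K)

    ≡±-closed : ∀ {x u} → x ≡± u → x ∈ K → u ∈ K
    ≡±-closed (inj₁ refl) x∈K = x∈K
    ≡±-closed (inj₂ refl) x∈K = subst (_∈ K) (⁻¹-involutive _) (neg-closed x∈K)

    ·-cancel : ∀ n .{{_ : ℕ.NonZero n}} {x} → n · x ∈ K → x ∈ K
    ·-cancel (suc m) {x} [1+m]x∈K with total 0# x
    ... | inj₁ 0≤x = convex zero-closed [1+m]x∈K 0≤x
                       (subst (_≤ suc m · x) (identityʳ x) (+-mono-≤₂ (≤-refl {x}) (·-nonneg m 0≤x)))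
    ... | inj₂ x≤0 = convex [1+m]x∈K zero-closed
                       (subst (suc m · x ≤_) (identityʳ x) (+-mono-≤₂ (≤-refl {x}) (·-nonpos m x≤0))) x≤0

  convexSubgroups-comparable : ∀ {ℓ₁ ℓ₂} {K : Pred Carrier ℓ₁} {L : Pred Carrier ℓ₂} →
                               IsConvexSubgroup G K → IsConvexSubgroup G L →
                               ∀ {x y} → x ∈ K → y ∈ L → x ∈ L ⊎ y ∈ K
  convexSubgroups-comparable K-convex L-convex {x} {y} x∈K y∈L
    with absolute x | absolute y
  ... | u , 0≤u , x≡±u | v , 0≤v , y≡±v with total u v
  ... | inj₁ u≤v = inj₁ (L.≡±-closed (≡±-sym x≡±u) (L.convex L.zero-closed (L.≡±-closed y≡±v y∈L) 0≤u u≤v))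
    where module L = ConvexSubgroup L-convex
  ... | inj₂ v≤u = inj₂ (K.≡±-closed (≡±-sym y≡±v) (K.convex K.zero-closed (K.≡±-closed x≡±u x∈K) 0≤v v≤u))
    where module K = ConvexSubgroup K-convex

  module _ {ℓ} {K : Pred Carrier ℓ} where

    plusMultiples-mono : ∀ {ℓ′} {L : Pred Carrier ℓ′} n → K ⊆ L → plusMultiples G K n ⊆ plusMultiples G L n
    plusMultiples-mono n K⊆L (h , h∈K , b , x≡h+nb) = h , K⊆L h∈K , b , x≡h+nb

    module _ (K-convex : IsConvexSubgroup G K) (n : ℕ) where
      open ConvexSubgroup K-convex

      multiples⊆plusMultiples : multiples G n ⊆ plusMultiples G K n
      multiples⊆plusMultiples (b , x≡nb) = 0# , zero-closed , b , trans x≡nb (sym (identityˡ _))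

      plusMultiples-zero : 0# ∈ plusMultiples G K n
      plusMultiples-zero = multiples⊆plusMultiples (0# , sym (·-zeroʳ n))

      plusMultiples-neg : ∀ {x} → x ∈ plusMultiples G K n → - x ∈ plusMultiples G K n
      plusMultiples-neg (h , h∈K , b , refl) =
        - h , neg-closed h∈K , - b , trans (-‿distrib-+ h _) (cong (- h +_) (sym (·-neg n b)))

      plusMultiples-sub : ∀ {x y} → x ∈ plusMultiples G K n → y ∈ plusMultiples G K n →
                          x - y ∈ plusMultiples G K n
      plusMultiples-sub (h , h∈K , b , refl) (h′ , h′∈K , b′ , refl) =
        h - h′ , sub-closed h∈K h′∈K , b - b′ ,
        trans ([x+y]-[u+v]≡[x-u]+[y-v] h _ h′ _) (cong ((h - h′) +_) (sym (·-distrib-sub n b b′)))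

  hull : Carrier → Pred Carrier 0ℓ
  hull x z = Σ ℕ λ m → - (m · ∣ x ∣) ≤ z × z ≤ m · ∣ x ∣

  hull-isConvexSubgroup : ∀ x → IsConvexSubgroup G (hull x)
  hull-isConvexSubgroup x = record
    { zero-closed = 0 , subst (_≤ 0#) (sym ε⁻¹≈ε) ≤-refl , ≤-refl
    ; +-closed    = λ { (m , -mu≤y , y≤mu) (m′ , -m′u≤y′ , y′≤m′u) → m ℕ.+ m′ ,
        subst (_≤ _) (trans (sym (-‿distrib-+ _ _)) (cong -_ (sym (·-homo-+ m m′ u))))
              (+-mono-≤₂ -mu≤y -m′u≤y′) ,
        subst (_ ≤_) (sym (·-homo-+ m m′ u)) (+-mono-≤₂ y≤mu y′≤m′u) }
    ; neg-closed  = λ { (m , -mu≤y , y≤mu) →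
        m , neg-mono-≤ y≤mu , subst (_ ≤_) (⁻¹-involutive _) (neg-mono-≤ -mu≤y) }
    ; convex      = λ { (m , -mu≤y , _) (m′ , _ , y′≤m′u) y≤z z≤y′ → m ℕ.+ m′ ,
        ≤-trans (neg-mono-≤ (·-monoˡ-≤ 0≤u m m′)) (≤-trans -mu≤y y≤z) ,
        ≤-trans z≤y′ (≤-trans y′≤m′u (subst (m′ · u ≤_) (cong (_· u) (ℕₚ.+-comm m′ m)) (·-monoˡ-≤ 0≤u m′ m))) }
    }
    where
    u = ∣ x ∣
    0≤u = proj₁ (proj₂ (absolute x))

  x∈hull : ∀ x → x ∈ hull x
  x∈hull x with absolute x
  ... | u , 0≤u , inj₁ refl = 1 , ≤-trans (subst (- (1 · u) ≤_) ε⁻¹≈ε (neg-mono-≤ (·-nonneg 1 0≤u))) 0≤u ,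
                              subst (u ≤_) (sym (identityʳ u)) ≤-refl
  ... | u , 0≤u , inj₂ refl = 1 , subst (λ v → - v ≤ - u) (sym (identityʳ u)) ≤-refl ,
                              ≤-trans (subst (- u ≤_) ε⁻¹≈ε (neg-mono-≤ 0≤u)) (·-nonneg 1 0≤u)

  hull-least : ∀ {ℓ} {K : Pred Carrier ℓ} → IsConvexSubgroup G K → ∀ {x} → x ∈ K → hull x ⊆ K
  hull-least K-convex {x} x∈K (m , -mu≤z , z≤mu) = convex (neg-closed mu∈K) mu∈K -mu≤z z≤mu
    where
    open ConvexSubgroup K-convex
    mu∈K = ·-closed m (≡±-closed (proj₂ (proj₂ (absolute x))) x∈K)

  ⊆𝔰 : ∀ n {a} {K : Pred Carrier 0ℓ} → IsConvexSubgroup G K → a ∉ plusMultiples G K n → K ⊆ 𝔰 G n a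
  ⊆𝔰 n K-convex a∉K+nG x∈K =
    a∉K+nG ∘ multiples⊆plusMultiples K-convex n , _ , K-convex , a∉K+nG , x∈K

  𝔰-isConvexSubgroup : ∀ n {a x} → x ∈ 𝔰 G n a → IsConvexSubgroup G (𝔰 G n a)
  𝔰-isConvexSubgroup n {a} (_ , K , K-convex , a∉K+nG , _) = record
    { zero-closed = ⊆𝔰 n K-convex a∉K+nG (IsConvexSubgroup.zero-closed K-convex)
    ; +-closed    = λ x∈𝔰 y∈𝔰 → common x∈𝔰 y∈𝔰 λ L-convex x∈L y∈L →
                      IsConvexSubgroup.+-closed L-convex x∈L y∈L
    ; neg-closed  = λ { (_ , L , L-convex , a∉L+nG , x∈L) →
                      ⊆𝔰 n L-convex a∉L+nG (IsConvexSubgroup.neg-closed L-convex x∈L) }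
    ; convex      = λ x∈𝔰 y∈𝔰 x≤z z≤y → common x∈𝔰 y∈𝔰 λ L-convex x∈L y∈L →
                      IsConvexSubgroup.convex L-convex x∈L y∈L x≤z z≤y
    }
    where
    -- two witnesses are comparable, so the larger one contains both points
    common : ∀ {x y z} → x ∈ 𝔰 G n a → y ∈ 𝔰 G n a →
             (∀ {L : Pred Carrier 0ℓ} → IsConvexSubgroup G L → x ∈ L → y ∈ L → z ∈ L) → z ∈ 𝔰 G n a
    common (_ , L , L-convex , a∉L+nG , x∈L) (_ , M , M-convex , a∉M+nG , y∈M) close
      with convexSubgroups-comparable L-convex M-convex x∈L y∈M
    ... | inj₁ x∈M = ⊆𝔰 n M-convex a∉M+nG (close M-convex x∈M y∈M)
    ... | inj₂ y∈L = ⊆𝔰 n L-convex a∉L+nG (close L-convex x∈L y∈L)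

  -- x ∈ 𝔰 n a is equivalent to the negative statement a ∉ hull x + nG.
  𝔰-stable : ∀ n {a x} → ¬ ¬ (x ∈ 𝔰 G n a) → x ∈ 𝔰 G n a
  𝔰-stable n {a} {x} ¬¬x∈𝔰 = ⊆𝔰 n (hull-isConvexSubgroup x) a∉hull+nG (x∈hull x)
    where
    a∉hull+nG : a ∉ plusMultiples G (hull x) n
    a∉hull+nG a∈hull+nG = ¬¬x∈𝔰 λ { (_ , K , K-convex , a∉K+nG , x∈K) →
                            a∉K+nG (plusMultiples-mono n (hull-least K-convex x∈K) a∈hull+nG) }

  G≤-sub : ∀ {k c n a b} → a ∈ G≤ G n (𝔰 G k c) → b ∈ G≤ G n (𝔰 G k c) → a - b ∈ G≤ G n (𝔰 G k c)
  G≤-sub {k} {c} {n} {a} {b} a∈G≤ b∈G≤ {x} (_ , K , K-convex , a-b∉K+nG , x∈K) =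
    𝔰-stable k λ x∉𝔰 → ¬¬-excluded-middle λ a∈K+nG? → ¬¬-excluded-middle λ b∈K+nG? →
    cases x∉𝔰 a∈K+nG? b∈K+nG?
    where
    cases : x ∉ 𝔰 G k c → Dec (a ∈ plusMultiples G K n) → Dec (b ∈ plusMultiples G K n) → ⊥
    cases x∉𝔰 (no a∉K+nG) _                 = x∉𝔰 (a∈G≤ (⊆𝔰 n K-convex a∉K+nG x∈K))
    cases x∉𝔰 (yes _)      (no b∉K+nG)      = x∉𝔰 (b∈G≤ (⊆𝔰 n K-convex b∉K+nG x∈K))
    cases _   (yes a∈K+nG) (yes b∈K+nG)     = a-b∉K+nG (plusMultiples-sub K-convex n a∈K+nG b∈K+nG)

  plusMultiples⊆G< : ∀ {k c n} → plusMultiples G (𝔰 G k c) n ⊆ G< G n (𝔰 G k c)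
  plusMultiples⊆G< {k} {c} {n} {a} (h , h∈𝔰 , b , a≡h+nb) = 𝔰a⊆𝔰c , 𝔰c⊈𝔰a
    where
    a∈K+nG : ∀ {K : Pred Carrier 0ℓ} → h ∈ K → a ∈ plusMultiples G K n
    a∈K+nG h∈K = h , h∈K , b , a≡h+nb
    𝔰a⊆𝔰c : 𝔰 G n a ⊆ 𝔰 G k c
    𝔰a⊆𝔰c (_ , K , K-convex , a∉K+nG , x∈K)
      with convexSubgroups-comparable K-convex (𝔰-isConvexSubgroup k h∈𝔰) x∈K h∈𝔰
    ... | inj₁ x∈𝔰 = x∈𝔰
    ... | inj₂ h∈K = ⊥-elim (a∉K+nG (a∈K+nG h∈K))
    𝔰c⊈𝔰a : ¬ (𝔰 G k c ⊆ 𝔰 G n a)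
    𝔰c⊈𝔰a 𝔰c⊆𝔰a with 𝔰c⊆𝔰a h∈𝔰
    ... | _ , K , _ , a∉K+nG , h∈K = a∉K+nG (a∈K+nG h∈K)

  G<⊆¬¬plusMultiples : ∀ {n c a} → a ∈ G< G n (𝔰 G n c) → ¬ ¬ (a ∈ plusMultiples G (𝔰 G n c) n)
  G<⊆¬¬plusMultiples {n} (_ , 𝔰c⊈𝔰a) a∉𝔰c+nG = 𝔰c⊈𝔰a λ { (_ , L , L-convex , c∉L+nG , x∈L) →
    ⊆𝔰 n L-convex (a∉𝔰c+nG ∘ plusMultiples-mono n (⊆𝔰 n L-convex c∉L+nG)) x∈L }

  G≤-divide : ∀ {k c} m n j .{{_ : ℕ.NonZero m}} {a h y} → a ∈ G≤ G (m ℕ.* (n ℕ.* j)) (𝔰 G k c) →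
              h ∈ 𝔰 G k c → a ≡ h + m · y → y ∈ G≤ G n (𝔰 G k c)
  G≤-divide {k} m n j {a} {h} {y} a∈G≤ h∈𝔰 a≡h+my {x} (_ , K , K-convex , y∉K+nG , x∈K)
    with convexSubgroups-comparable K-convex (𝔰-isConvexSubgroup k h∈𝔰) x∈K h∈𝔰
  ... | inj₁ x∈𝔰 = x∈𝔰
  ... | inj₂ h∈K = a∈G≤ (⊆𝔰 (m ℕ.* (n ℕ.* j)) K-convex a∉K+mnjG x∈K)
    where
    open ConvexSubgroup K-convex
    a∉K+mnjG : a ∉ plusMultiples G K (m ℕ.* (n ℕ.* j))
    a∉K+mnjG (h′ , h′∈K , z , a≡h′+mnjz) = y∉K+nG (w , w∈K , j · z , y≡w+njz)
      where
      open ≡-Reasoning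
      w = y - (n ℕ.* j) · z
      mw≡h′-h : m · w ≡ h′ - h
      mw≡h′-h = begin
        m · w                          ≡⟨ ·-distrib-sub m y _ ⟩
        m · y - m · (n ℕ.* j) · z      ≡⟨ cong₂ _-_ (x≡y+z⇒z≡x-y a≡h+my) (sym (·-assoc m _ z)) ⟩
        (a - h) - (m ℕ.* (n ℕ.* j)) · z ≡⟨ cong (λ t → (a - h) - t) (x≡y+z⇒z≡x-y a≡h′+mnjz) ⟩
        (a - h) - (a - h′)             ≡⟨ [x-y]-[x-z]≡z-y a h h′ ⟩
        h′ - h                         ∎
      w∈K : w ∈ K
      w∈K = ·-cancel m (subst (_∈ K) (sym mw≡h′-h) (sub-closed h′∈K h∈K))
      y≡w+njz : y ≡ w + n · j · z
      y≡w+njz = sym (trans (cong (w +_) (sym (·-assoc n j z))) (x-y+y≡x y _))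

  Apart : ∀ {ℓ} → Pred Carrier ℓ → Rel Carrier ℓ
  Apart Y x y = x - y ∉ Y × y - x ∉ Y

  -- QuotientCardLt with the family given as a list, the form in which the counting arguments are inductions.
  CardLt : ∀ {ℓ₁ ℓ₂} → Pred Carrier ℓ₁ → Pred Carrier ℓ₂ → ℕ → Set (ℓ₁ ⊔ ℓ₂)
  CardLt X Y M = ∀ xs → All X xs → AllPairs (Apart Y) xs → length xs ℕ.< M

  module _ {ℓ₁ ℓ₂} {X : Pred Carrier ℓ₁} {Y : Pred Carrier ℓ₂} where

    QuotientCardLt⇒CardLt : ∀ M → QuotientCardLt G X Y M → CardLt X Y M
    QuotientCardLt⇒CardLt M card< xs X-xs apart = decidable-stable (length xs ℕₚ.<? M) λ ¬xs<M →
      let M≤xs = ℕₚ.≮⇒≥ ¬xs<M in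
      card< (λ i → lookup xs (Fin.inject≤ i M≤xs)) (λ _ → All.lookup X-xs (∈-lookup _)) (injective M≤xs)
      where
      injective : ∀ M≤xs i j → lookup xs (Fin.inject≤ i M≤xs) - lookup xs (Fin.inject≤ j M≤xs) ∈ Y → i ≡ j
      injective M≤xs i j d with Finₚ.<-cmp (Fin.inject≤ i M≤xs) (Fin.inject≤ j M≤xs)
      ... | tri< i<j _ _ = ⊥-elim (proj₁ (AllPairs-lookup {R = Apart Y} apart i<j) d)
      ... | tri≈ _ i≡j _ = Finₚ.inject≤-injective M≤xs M≤xs i j i≡j
      ... | tri> _ _ j<i = ⊥-elim (proj₂ (AllPairs-lookup {R = Apart Y} apart j<i) d)

    CardLt⇒QuotientCardLt : ∀ M → CardLt X Y M → QuotientCardLt G X Y M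
    CardLt⇒QuotientCardLt M card< f X-f f-injective = ℕₚ.<-irrefl (length-tabulate f)
      (card< (tabulate f) (Allₚ.tabulate⁺ X-f)
             (AllPairsₚ.tabulate⁺ λ {i} {j} i≢j → i≢j ∘ f-injective i j , i≢j ∘ sym ∘ f-injective j i))

    cardLt-mono : ∀ {ℓ₁′ ℓ₂′} {X′ : Pred Carrier ℓ₁′} {Y′ : Pred Carrier ℓ₂′} {M} →
                  X′ ⊆ X → Y ⊆ Y′ → CardLt X Y M → CardLt X′ Y′ M
    cardLt-mono X′⊆X Y⊆Y′ card< xs X′-xs apart =
      card< xs (All.map X′⊆X X′-xs) (AllPairs.map (λ (d , d′) → d ∘ Y⊆Y′ , d′ ∘ Y⊆Y′) apart)

    quotientCardLt-mono : ∀ {ℓ₁′ ℓ₂′} {X′ : Pred Carrier ℓ₁′} {Y′ : Pred Carrier ℓ₂′} {M} →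
                          X′ ⊆ X → Y ⊆ Y′ → QuotientCardLt G X Y M → QuotientCardLt G X′ Y′ M
    quotientCardLt-mono X′⊆X Y⊆Y′ card< f X′-f f-injective =
      card< f (X′⊆X ∘ X′-f) λ i j → f-injective i j ∘ Y⊆Y′

    cardLt-transfer : ∀ {ℓ₃ ℓ₄ ℓ} {P : Pred Carrier ℓ₃} {Q : Pred Carrier ℓ₄} {ρ : Rel Carrier ℓ} {M} →
                      (∀ {x} → x ∈ X → ∃ λ y → ρ x y × y ∈ P) →
                      (∀ {x x′ y y′} → ρ x y → ρ x′ y′ → Apart Y x x′ → Apart Q y y′) →
                      CardLt P Q M → CardLt X Y M
    cardLt-transfer {P = P} {ρ = ρ} {M} choose reflect card< xs X-xs apart
      with Pointwise-choice {R = λ x y → ρ x y × y ∈ P} choose X-xs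
    ... | ys , ρ-xs-ys = subst (ℕ._< M) (sym (Pointwise-length ρ-xs-ys))
      (card< ys (Pointwise-All proj₂ ρ-xs-ys)
                (Pointwise-AllPairs (λ r r′ → reflect (proj₁ r) (proj₁ r′)) ρ-xs-ys apart))

  cardLt-* : ∀ {ℓ₁ ℓ₂ ℓ₃ ℓ₄} {X : Pred Carrier ℓ₁} {X′ : Pred Carrier ℓ₂} {B : Pred Carrier ℓ₃}
               {C : Pred Carrier ℓ₄} {k n} → 0# ∈ B → (∀ {x} → x ∈ B → - x ∈ B) →
             (∀ {x y} → x ∈ X → y ∈ X → x - y ∈ B → x - y ∈ X′) →
             CardLt X B k → CardLt X′ C n → CardLt X C (k ℕ.* n)
  cardLt-* {X = X} {X′} {B} {C} {k} {n} 0∈B B-neg X-diff card<k card<n xs X-xs C-apart =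
    go k xs X-xs C-apart λ zs zs⊆xs → card<k zs (All.map (All.lookup X-xs) zs⊆xs)
    where
    -- Split off the B-class of the head y: translated by - y it is C-apart in X′, so it has fewer
    -- than n elements, while B-apart families in the rest extend by y, so have fewer than k′ elements.
    -- The split is decided only under double negation, which suffices as the goal is decidable.
    go : ∀ k′ ys → All X ys → AllPairs (Apart C) ys →
         (∀ zs → All (_∈ₗ ys) zs → AllPairs (Apart B) zs → length zs ℕ.< k′) → length ys ℕ.< k′ ℕ.* n
    go zero     _        _            _                    few = ⊥-elim (ℕₚ.n≮0 (few [] [] []))
    go (suc k′) []       _            _                    _   = ℕₚ.<-≤-trans (card<n [] [] []) (ℕₚ.m≤m+n n _)
    go (suc k′) (y ∷ ys) (y∈X ∷ ys⊆X) (y-apart ∷ ys-apart) few =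
      decidable-stable (_ ℕₚ.<? _) λ ¬goal →
      All-¬¬ (λ _ → ¬¬-excluded-middle) ys λ B? → ¬goal (count (partition B?))
      where
      count : Partition (λ t → t - y ∈ B) ys → suc (length ys) ℕ.< suc k′ ℕ.* n
      count π = subst (λ l → suc l ℕ.< n ℕ.+ k′ ℕ.* n) length-partition
                      (ℕₚ.+-mono-<-≤ class< (ℕₚ.<⇒≤ rest<))
        where
        open Partition π

        class = map (_- y) (y ∷ inside)

        class⊆X′ : All X′ class
        class⊆X′ = Allₚ.map⁺ (X-diff y∈X y∈X (subst (_∈ B) (sym (inverseʳ y)) 0∈B) ∷
          All.zipWith (λ (t∈X , t-y∈B) → X-diff t∈X y∈X t-y∈B) (All-resp-⊆ inside⊑ ys⊆X , all-inside))

        shift : ∀ {t t′} → Apart C t t′ → Apart C (t - y) (t′ - y)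
        shift {t} {t′} (d , d′) = d ∘ subst (_∈ C) ([x-z]-[y-z]≡x-y t t′ y) ,
                                  d′ ∘ subst (_∈ C) ([x-z]-[y-z]≡x-y t′ t y)

        class< : suc (length inside) ℕ.< n
        class< = subst (ℕ._< n) (length-map (_- y) (y ∷ inside)) (card<n class class⊆X′
          (AllPairsₚ.map⁺ (AllPairs.map shift (AllPairs-resp-⊑ (refl ∷ inside⊑) (y-apart ∷ ys-apart)))))

        y-apart-outside : ∀ {t} → t ∈ₗ outside → Apart B y t
        y-apart-outside t∈ = t-y∉B ∘ subst (_∈ B) (⁻¹-anti-homo‿- y _) ∘ B-neg , t-y∉B
          where t-y∉B = All.lookup none-outside t∈

        rest< : length outside ℕ.< k′ ℕ.* n
        rest< = go k′ outside (All-resp-⊆ outside⊑ ys⊆X) (AllPairs-resp-⊑ outside⊑ ys-apart)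
          λ zs zs⊆outside zs-apart → ℕₚ.≤-pred (few (y ∷ zs)
            (here refl ∷ All.map (there ∘ Any-resp-⊆ outside⊑) zs⊆outside)
            (All.map y-apart-outside zs⊆outside ∷ zs-apart))

  RCardLt-resp-≐ : ∀ {n M} {H H′ : Pred Carrier (lsuc 0ℓ)} → _≐_ G H H′ → RCardLt G n H M → RCardLt G n H′ M
  RCardLt-resp-≐ {n} {H = H} {H′} (H⊆H′ , H′⊆H) =
    quotientCardLt-mono {X = G≤ G n H} {Y = G< G n H} {X′ = G≤ G n H′} {Y′ = G< G n H′}
      (λ 𝔰a⊆H′ {x} x∈𝔰a → H′⊆H (𝔰a⊆H′ x∈𝔰a))
      (λ (𝔰a⊆H , H⊈𝔰a) → (λ {x} x∈𝔰a → H⊆H′ (𝔰a⊆H x∈𝔰a)) , λ H′⊆𝔰a → H⊈𝔰a λ {x} x∈H → H′⊆𝔰a (H⊆H′ x∈H))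

  module Filtration (p : ℕ) .{{_ : ℕ.NonZero p}} {c x₀ : Carrier} (x₀∈𝔰 : x₀ ∈ 𝔰 G p c)
                    (N : ℕ) (card<N : RCardLt G p (𝔰 G p c) N) (d : ℕ) where

    S : Pred Carrier (lsuc 0ℓ)
    S = 𝔰 G p c

    A : Pred Carrier (lsuc 0ℓ)
    A = G≤ G (p ^ suc d) S

    B : ℕ → Pred Carrier (lsuc 0ℓ)
    B i = plusMultiples G S (p ^ i)

    S-convex : IsConvexSubgroup G S
    S-convex = 𝔰-isConvexSubgroup p x₀∈𝔰

    open ConvexSubgroup S-convex

    Digit : ℕ → Rel Carrier (lsuc 0ℓ)
    Digit i a y = Σ Carrier λ h → h ∈ S × a ≡ h + p ^ i · y

    Digit-sub : ∀ i {a a′ y y′} → Digit i a y → Digit i a′ y′ →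
                y - y′ ∈ plusMultiples G S p → a - a′ ∈ B (suc i)
    Digit-sub i {y = y} {y′} (h , h∈S , refl) (h′ , h′∈S , refl) (h″ , h″∈S , w , y-y′≡h″+pw) =
      (h - h′) + p ^ i · h″ , +-closed (sub-closed h∈S h′∈S) (·-closed (p ^ i) h″∈S) , w , (begin
        (h + p ^ i · y) - (h′ + p ^ i · y′)     ≡⟨ [x+y]-[u+v]≡[x-u]+[y-v] h _ h′ _ ⟩
        (h - h′) + (p ^ i · y - p ^ i · y′)     ≡⟨ cong ((h - h′) +_) (·-distrib-sub (p ^ i) y y′) ⟨
        (h - h′) + p ^ i · (y - y′)             ≡⟨ cong (λ t → (h - h′) + p ^ i · t) y-y′≡h″+pw ⟩
        (h - h′) + p ^ i · (h″ + p · w)         ≡⟨ cong ((h - h′) +_) (·-distrib-+ (p ^ i) h″ (p · w)) ⟩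
        (h - h′) + (p ^ i · h″ + p ^ i · p · w) ≡⟨ assoc _ _ _ ⟨
        ((h - h′) + p ^ i · h″) + p ^ i · p · w ≡⟨ cong (((h - h′) + p ^ i · h″) +_) p^i·p·w≡p^[1+i]·w ⟩
        ((h - h′) + p ^ i · h″) + p ^ suc i · w ∎)
      where
      open ≡-Reasoning
      p^i·p·w≡p^[1+i]·w : p ^ i · p · w ≡ p ^ suc i · w
      p^i·p·w≡p^[1+i]·w = trans (sym (·-assoc (p ^ i) p w)) (cong (_· w) (ℕₚ.*-comm (p ^ i) p))

    cardLt-layer : ∀ i e → i ℕ.+ suc e ≡ suc d → CardLt (A ∩ B i) (B (suc i)) N
    cardLt-layer i e i+1+e≡1+d =
      cardLt-transfer {X = A ∩ B i} {Y = B (suc i)} {P = G≤ G p S} {Q = G< G p S} {ρ = Digit i} digit apart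
                      (QuotientCardLt⇒CardLt {X = G≤ G p S} {Y = G< G p S} N card<N)
      where
      p^[1+d]≡p^i*[p*p^e] : p ^ suc d ≡ p ^ i ℕ.* (p ℕ.* p ^ e)
      p^[1+d]≡p^i*[p*p^e] = trans (cong (p ^_) (sym i+1+e≡1+d)) (ℕₚ.^-distribˡ-+-* p i (suc e))

      digit : ∀ {a} → a ∈ A ∩ B i → ∃ λ y → Digit i a y × y ∈ G≤ G p S
      digit {a} (a∈A , h , h∈S , y , a≡h+p^iy) = y , (h , h∈S , a≡h+p^iy) ,
        G≤-divide {p} {c} (p ^ i) p (p ^ e) {{ℕₚ.m^n≢0 p i}}
                  (subst (λ n → a ∈ G≤ G n S) p^[1+d]≡p^i*[p*p^e] a∈A) h∈S a≡h+p^iy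

      apart : ∀ {a a′ y y′} → Digit i a y → Digit i a′ y′ → Apart (B (suc i)) a a′ → Apart (G< G p S) y y′
      apart δ δ′ (a-a′∉B , a′-a∉B) =
        (λ y-y′∈G< → G<⊆¬¬plusMultiples {p} {c} y-y′∈G< (a-a′∉B ∘ Digit-sub i δ δ′)) ,
        (λ y′-y∈G< → G<⊆¬¬plusMultiples {p} {c} y′-y∈G< (a′-a∉B ∘ Digit-sub i δ′ δ))

    cardLt-layers : ∀ e i → i ℕ.+ suc e ≡ suc d → CardLt (A ∩ B i) (B (suc d)) (N ^ suc e)
    cardLt-layers zero i i+1≡1+d = subst₂ (CardLt (A ∩ B i)) (cong B (trans (ℕₚ.+-comm 1 i) i+1≡1+d))
                                   (sym (ℕₚ.*-identityʳ N)) (cardLt-layer i 0 i+1≡1+d)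
    cardLt-layers (suc e) i i+2+e≡1+d =
      cardLt-* {X = A ∩ B i} {X′ = A ∩ B (suc i)} {B (suc i)} {B (suc d)}
               (plusMultiples-zero S-convex (p ^ suc i)) (plusMultiples-neg S-convex (p ^ suc i))
               (λ (a∈A , _) (b∈A , _) a-b∈B → (λ {x} → G≤-sub {p} {c} {p ^ suc d} a∈A b∈A {x}) , a-b∈B)
               (cardLt-layer i (suc e) i+2+e≡1+d)
               (cardLt-layers e (suc i) (trans (sym (ℕₚ.+-suc i (suc e))) i+2+e≡1+d))

    RCardLt-p^[1+d] : RCardLt G (p ^ suc d) S (N ^ suc d)
    RCardLt-p^[1+d] = CardLt⇒QuotientCardLt {X = A} {Y = G< G (p ^ suc d) S} _
      (cardLt-mono {X = A ∩ B 0} {Y = B (suc d)} {X′ = A} (λ {a} a∈A → (λ {x} → a∈A {x}) , B-zero-full a)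
                   (plusMultiples⊆G< {p} {c} {p ^ suc d}) (cardLt-layers d 0 refl))
      where
      B-zero-full : ∀ a → a ∈ B 0
      B-zero-full a = 0# , zero-closed , a , sym (trans (identityˡ _) (identityʳ a))

open import Data.Nat using (_<_; _≤_)

lemma3p4 : (G : OrderedAbelianGroup) →
    ((p : ℕ) → Prime p → Σ ℕ λ N → 1 < N ×
      (∀ H → InS G p H → ¬ (_≐_ G H (∅ G)) → RCardLt G p H N)) →
    (p : ℕ) → Prime p → (r : ℕ) → 1 ≤ r → Σ ℕ λ N → 1 < N ×
      (∀ H → InS G p H → ¬ (_≐_ G H (∅ G)) → RCardLt G (p ^ r) H N)
lemma3p4 G R-bounded p p-prime zero ()
lemma3p4 G R-bounded p p-prime (suc d) _ with R-bounded p p-prime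
... | N , 1<N , card<N = N ^ suc d , ℕₚ.^-monoʳ-< N 1<N {0} {suc d} ℕ.z<s , card<N^[1+d]
  where
  card<N^[1+d] : ∀ H → InS G p H → ¬ (_≐_ G H (∅ G)) → RCardLt G (p ^ suc d) H (N ^ suc d)
  card<N^[1+d] H (c , H⊆𝔰 , 𝔰⊆H) H≢∅ f f∈G≤ f-injective = H≢∅ ((λ x∈H → ⊥-at (H⊆𝔰 x∈H)) , λ ())
    where
    -- the goal is ⊥, so refuting H ≐ ∅ lets us assume a point of H
    ⊥-at : ∀ {x} → x ∈ 𝔰 G p c → ⊥
    ⊥-at x∈𝔰 = RCardLt-resp-≐ G {p ^ suc d} (𝔰⊆H , H⊆𝔰)
      (Filtration.RCardLt-p^[1+d] G p {{prime⇒nonZero p-prime}} x∈𝔰 N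
        (RCardLt-resp-≐ G {p} (H⊆𝔰 , 𝔰⊆H) (card<N H (c , H⊆𝔰 , 𝔰⊆H) H≢∅)) d)
      f f∈G≤ f-injective
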